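{- Let $S$ be a finite set of first-order clauses and let $\mathrm{ren}(S)=\{\mathrm{skel}(C_v^{\max}) : C\in S,\ v\in\mathrm{var}(C)\}$, a set of propositional clauses. Then for every interpretation $M$ of the propositional variables (identified with the predicate symbols of $S$), the renamed clause set $r_M(S)$ belongs to the class \textbf{PVD} if and only if $M$ is a model of $\mathrm{ren}(S)$.
   Context: A clause is a finite set of literals (atoms $P(t_1,\dots,t_n)$ or their negations). The dual $\overline{L}$ of $P(\cdots)$ is $\neg P(\cdots)$ and vice versa. For a clause $C$, $C^+$ and $C^-$ denote its sets of positive and negative literals. $\mathrm{var}(E)$ is the set of variables occurring in $E$. A renaming is a set $r$ of predicate symbols; $r(L)=\overline{L}$ if the predicate symbol of $L$ is in $r$ and $r(L)=L$ otherwise; $r(C)=\{r(L):L\in C\}$, $r(S)=\{r(C):C\in S\}$. For an interpretation $M$ of propositional variables, $r_M$ is the set of propositional variables true in $M$. The propositional skeleton: $\mathrm{skel}(P(\cdots))=P$, $\mathrm{skel}(\neg P(\cdots))=\neg P$, with $P$ read as a propositional variable; for a set of literals, $\mathrm{skel}$ is applied elementwise, giving a propositional clause. Maximal depth of occurrence: $\tau_{\max}(v,v)=0$, $\tau_{\max}(v,f(t_1,\dots,t_n))=1+\max\{\tau_{\max}(v,t_i): v\in\mathrm{var}(t_i)\}$; for an atom or literal $\pm P(t_1,\dots,t_n)$ containing $v$, it is the maximum over the arguments containing $v$; for a set of literals, the maximum over the literals containing $v$. For a variable $v$ occurring in a clause $C$, $C_v^{\max}=\{L\in C: v\in\mathrm{var}(L),\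 \tau_{\max}(v,L)=\tau_{\max}(v,C)\}$. A clause set $S$ is in \textbf{PVD} iff for every clause $C\in S$ and every variable $v\in\mathrm{var}(C^+)$: $v\in\mathrm{var}(C^-)$ and $\tau_{\max}(v,C^+)\le\tau_{\max}(v,C^-)$. -}

module Defs where

open import Data.Nat using (ℕ; zero; suc; _⊔_; _≤_; _≡ᵇ_)
open import Data.Bool using (Bool; true; false; not; _∧_; _∨_; if_then_else_; T)
open import Data.List using (List; []; _∷_; map; filterᵇ)
open import Data.List.Membership.Propositional using (_∈_)
open import Data.List.Relation.Unary.Any using (Any)
open import Data.Product using (_×_; Σ; _,_)
open import Relation.Binary.PropositionalEquality using (_≡_)

data Term : Set where
  var : ℕ → Term
  fun : ℕ → List Term → Term

-- A literal: polarity (true = positive atom P(ts), false = ¬P(ts)),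
-- predicate symbol, argument list.
record Literal : Set where
  constructor lit
  field
    pos  : Bool
    pred : ℕ
    args : List Term
open Literal public

-- A clause is a finite set of literals (represented by a list);
-- a clause set is a finite set of clauses (a list of clauses).
Clause : Set
Clause = List Literal

ClauseSet : Set
ClauseSet = List Clause

dual : Literal → Literal
dual (lit b P ts) = lit (not b) P ts

mutual
  occT : ℕ → Term → Bool
  occT v (var w)    = v ≡ᵇ w
  occT v (fun f ts) = occTs v ts

  occTs : ℕ → List Term → Bool
  occTs v []       = false
  occTs v (t ∷ ts) = occT v t ∨ occTs v ts

occL : ℕ → Literal → Bool
occL v L = occTs v (args L)

occC : ℕ → Clause → Bool
occC v []      = false
occC v (L ∷ C) = occL v L ∨ occC v C

-- maximal depth of occurrence τ_max (meaningful when v occurs);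
-- maxima range over the subexpressions containing v.
mutual
  τT : ℕ → Term → ℕ
  τT v (var w)    = 0
  τT v (fun f ts) = suc (τTs v ts)

  τTs : ℕ → List Term → ℕ
  τTs v []       = 0
  τTs v (t ∷ ts) = if occT v t then τT v t ⊔ τTs v ts else τTs v ts

τL : ℕ → Literal → ℕ
τL v L = τTs v (args L)

τC : ℕ → Clause → ℕ
τC v []      = 0
τC v (L ∷ C) = if occL v L then τL v L ⊔ τC v C else τC v C

posPart : Clause → Clause
posPart = filterᵇ pos

negPart : Clause → Clause
negPart = filterᵇ (λ L → not (pos L))

Cmax : ℕ → Clause → Clause
Cmax v C = filterᵇ (λ L → occL v L ∧ (τL v L ≡ᵇ τC v C)) C

-- renamings r (sets of predicate symbols, given by characteristic function)
Renaming : Set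
Renaming = ℕ → Bool

renL : Renaming → Literal → Literal
renL r L = if r (pred L) then dual L else L

renC : Renaming → Clause → Clause
renC r = map (renL r)

renS : Renaming → ClauseSet → ClauseSet
renS r = map (renC r)

-- propositional literals / clauses: (polarity, propositional variable)
PLit : Set
PLit = Bool × ℕ

PClause : Set
PClause = List PLit

skelL : Literal → PLit
skelL L = (pos L , pred L)

skel : Clause → PClause
skel = map skelL

Interp : Set
Interp = ℕ → Bool

-- r_M : the set of propositional variables true in M
rOf : Interp → Renaming
rOf M = M

SatPLit : Interp → PLit → Set
SatPLit M (b , P) = M P ≡ b

SatPClause : Interp → PClause → Set
SatPClause M C = Any (SatPLit M) C

InRen : ClauseSet → PClause → Set
InRen S D = Σ Clause λ C → Σ ℕ λ v → C ∈ S × T (occC v C) × D ≡ skel (Cmax v C)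

ModelOfRen : Interp → ClauseSet → Set
ModelOfRen M S = ∀ D → InRen S D → SatPClause M D

PVD : ClauseSet → Set
PVD S = ∀ C → C ∈ S → ∀ v → T (occC v (posPart C)) →
          T (occC v (negPart C)) × τC v (posPart C) ≤ τC v (negPart C)

{-# OPTIONS --safe #-}
module Submission where

open import Defs
open import Function.Bundles using (_⇔_; mk⇔; Equivalence)
open import Function.Properties.Equivalence using () renaming (sym to ⇔-sym; trans to ⇔-trans)
open import Data.Nat using (ℕ; _⊔_; _≤_; _≡ᵇ_; z≤n; _≤?_)
open import Data.Nat.Properties
  using (≤-antisym; ≰⇒≥; m≤m⊔n; m≤n⇒m≤o⊔n; ⊔-lub; ⊔-identityʳ; m≥n⇒m⊔n≡m; m≤n⇒m⊔n≡n; ≡ᵇ⇒≡; ≡⇒≡ᵇ; module ≤-Reasoning)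
open import Data.Bool using (Bool; true; false; not; _∧_; _∨_; T; T?)
open import Data.Bool.Properties using (T-≡; T-∧)
open import Data.List using (List; []; _∷_; map; filterᵇ)
open import Data.List.Membership.Propositional using (_∈_; find; lose)
open import Data.List.Membership.Propositional.Properties using (∈-map⁺; ∈-map⁻; ∈-filter⁺; ∈-filter⁻)
open import Data.List.Relation.Unary.Any using (Any; here; there)
import Data.List.Relation.Unary.Any as Any
import Data.List.Relation.Unary.Any.Properties as Anyₚ
open import Data.Product using (_×_; ∃-syntax; _,_; proj₁)
open import Data.Sum using (_⊎_; inj₁; inj₂)
open import Data.Unit using (tt)
open import Function using (_∘_)
open import Relation.Nullary using (yes; no)
open import Relation.Binary.PropositionalEquality using (_≡_; refl; sym; trans; cong; cong₂; subst; _≗_)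

open Equivalence using (to; from)

-- Renaming by r_M only flips polarities, so variables and depths are unchanged, and it makes
-- a literal negative exactly when M satisfies its skeleton. For a clause D and a variable v
-- of D, the PVD condition at v holds iff D_v^max contains a negative literal: such a literal
-- lies in D⁻ and has the depth of all of D, bounding the depth in D⁺; conversely, if the
-- maximal depth of D is attained by a positive literal, the PVD bound pushes the maximum of
-- D⁻ up to it. For D = r_M(C) this says precisely that M satisfies skel(C_v^max).

filterᵇ-map : ∀ {A : Set} (p : A → Bool) (f : A → A) → p ∘ f ≗ p →
              ∀ xs → filterᵇ p (map f xs) ≡ map f (filterᵇ p xs)
filterᵇ-map p f p∘f≗p []       = refl
filterᵇ-map p f p∘f≗p (x ∷ xs) with p (f x) | p x | p∘f≗p x
... | true  | true  | refl = cong (f x ∷_) (filterᵇ-map p f p∘f≗p xs)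
... | false | false | refl = filterᵇ-map p f p∘f≗p xs

∀∈-cong : ∀ {A : Set} {P Q : A → Set} {xs : List A} →
          (∀ x → P x ⇔ Q x) → (∀ x → x ∈ xs → P x) ⇔ (∀ x → x ∈ xs → Q x)
∀∈-cong P⇔Q = mk⇔ (λ p x x∈ → to (P⇔Q x) (p x x∈)) (λ q x x∈ → from (P⇔Q x) (q x x∈))

occL⇒occC : ∀ v {L C} → L ∈ C → T (occL v L) → T (occC v C)
occL⇒occC v {C = L ∷ C} (here refl) occ with occL v L
... | true = tt
occL⇒occC v {C = L ∷ C} (there L′∈C) occ with occL v L
... | true  = tt
... | false = occL⇒occC v L′∈C occ

occC⇒occL : ∀ v C → T (occC v C) → ∃[ L ] L ∈ C × T (occL v L)
occC⇒occL v (L ∷ C) occ with occL v L in eq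
... | true  = L , here refl , from T-≡ eq
... | false = let L′ , L′∈C , occL′ = occC⇒occL v C occ in L′ , there L′∈C , occL′

occC-filterᵇ⁻ : ∀ v p C → T (occC v (filterᵇ p C)) → T (occC v C)
occC-filterᵇ⁻ v p C occ =
  let L , L∈ , occL = occC⇒occL v (filterᵇ p C) occ
  in occL⇒occC v (proj₁ (∈-filter⁻ (T? ∘ p) {xs = C} L∈)) occL

τL≤τC : ∀ v {L C} → L ∈ C → T (occL v L) → τL v L ≤ τC v C
τL≤τC v {C = L ∷ C} (here refl) occ with occL v L
... | true = m≤m⊔n _ _
τL≤τC v {C = L ∷ C} (there L′∈C) occ with occL v L
... | true  = m≤n⇒m≤o⊔n (τL v L) (τL≤τC v L′∈C occ)
... | false = τL≤τC v L′∈C occ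

τC-lub : ∀ v C {n} → (∀ {L} → L ∈ C → T (occL v L) → τL v L ≤ n) → τC v C ≤ n
τC-lub v []      bound = z≤n
τC-lub v (L ∷ C) bound with occL v L in eq
... | true  = ⊔-lub (bound (here refl) (from T-≡ eq)) (τC-lub v C (bound ∘ there))
... | false = τC-lub v C (bound ∘ there)

τC-filterᵇ≤ : ∀ v p C → τC v (filterᵇ p C) ≤ τC v C
τC-filterᵇ≤ v p C = τC-lub v (filterᵇ p C) (τL≤τC v ∘ proj₁ ∘ ∈-filter⁻ (T? ∘ p) {xs = C})

τC-absent : ∀ v C → occC v C ≡ false → τC v C ≡ 0
τC-absent v []      _ = refl
τC-absent v (L ∷ C) absent with occL v L
... | false = τC-absent v C absent

τC-attained : ∀ v C → T (occC v C) → ∃[ L ] L ∈ C × T (occL v L) × τL v L ≡ τC v C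
τC-attained v (L ∷ C) occ with occL v L in eqL
... | false = let L′ , L′∈C , occL′ , τ≡ = τC-attained v C occ in L′ , there L′∈C , occL′ , τ≡
... | true with occC v C in eqC
...   | false = L , here refl , from T-≡ eqL ,
                trans (sym (⊔-identityʳ _)) (cong (τL v L ⊔_) (sym (τC-absent v C eqC)))
...   | true with τC v C ≤? τL v L
...     | yes τC≤τL = L , here refl , from T-≡ eqL , sym (m≥n⇒m⊔n≡m τC≤τL)
...     | no  τC≰τL = let L′ , L′∈C , occL′ , τ≡ = τC-attained v C (from T-≡ eqC)
                      in L′ , there L′∈C , occL′ , trans τ≡ (sym (m≤n⇒m⊔n≡n (≰⇒≥ τC≰τL)))

∈-Cmax⁺ : ∀ v {L C} → L ∈ C → T (occL v L) → τL v L ≡ τC v C → L ∈ Cmax v C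
∈-Cmax⁺ v L∈C occ τ≡ = ∈-filter⁺ (T? ∘ _) L∈C (from T-∧ (occ , ≡⇒≡ᵇ _ _ τ≡))

∈-Cmax⁻ : ∀ v C {L} → L ∈ Cmax v C → L ∈ C × T (occL v L) × τL v L ≡ τC v C
∈-Cmax⁻ v C {L} L∈max =
  let L∈C , maximal = ∈-filter⁻ (T? ∘ _) {xs = C} L∈max
      occ , τ≡ᵇ = to T-∧ maximal
  in L∈C , occ , ≡ᵇ⇒≡ (τL v L) (τC v C) τ≡ᵇ

Negative : Literal → Set
Negative L = T (not (pos L))

negative-or-positive : ∀ L → Negative L ⊎ T (pos L)
negative-or-positive (lit false _ _) = inj₁ tt
negative-or-positive (lit true  _ _) = inj₂ tt

PVDAt : ℕ → Clause → Set
PVDAt v D = T (occC v (posPart D)) → T (occC v (negPart D)) × τC v (posPart D) ≤ τC v (negPart D)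

PVDClause : Clause → Set
PVDClause D = ∀ v → PVDAt v D

negativeMaximal⇒pvdAt : ∀ v D → Any Negative (Cmax v D) → PVDAt v D
negativeMaximal⇒pvdAt v D negMax _ with find negMax
... | L , L∈max , negL with ∈-Cmax⁻ v D L∈max
...   | L∈D , occL , τL≡τD = occL⇒occC v L∈D⁻ occL , (begin
    τC v (posPart D)  ≤⟨ τC-filterᵇ≤ v pos D ⟩
    τC v D            ≡⟨ sym τL≡τD ⟩
    τL v L            ≤⟨ τL≤τC v L∈D⁻ occL ⟩
    τC v (negPart D)  ∎)
  where
  open ≤-Reasoning
  L∈D⁻ : L ∈ negPart D
  L∈D⁻ = ∈-filter⁺ (T? ∘ (not ∘ pos)) {xs = D} L∈D negL

pvdAt∧positiveMaximal⇒negativeMaximal : ∀ v D {L₀} → PVDAt v D →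
  L₀ ∈ posPart D → T (occL v L₀) → τL v L₀ ≡ τC v D → Any Negative (Cmax v D)
pvdAt∧positiveMaximal⇒negativeMaximal v D {L₀} pvd L₀∈D⁺ occL₀ τL₀≡τD
  with pvd (occL⇒occC v L₀∈D⁺ occL₀)
... | occD⁻ , τD⁺≤τD⁻ with τC-attained v (negPart D) occD⁻
...   | L₁ , L₁∈D⁻ , occL₁ , τL₁≡τD⁻ with ∈-filter⁻ (T? ∘ (not ∘ pos)) {xs = D} L₁∈D⁻
...     | L₁∈D , negL₁ = lose (∈-Cmax⁺ v L₁∈D occL₁ (≤-antisym (τL≤τC v L₁∈D occL₁) τD≤τL₁)) negL₁
  where
  open ≤-Reasoning
  τD≤τL₁ : τC v D ≤ τL v L₁
  τD≤τL₁ = begin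
    τC v D            ≡⟨ sym τL₀≡τD ⟩
    τL v L₀           ≤⟨ τL≤τC v L₀∈D⁺ occL₀ ⟩
    τC v (posPart D)  ≤⟨ τD⁺≤τD⁻ ⟩
    τC v (negPart D)  ≡⟨ sym τL₁≡τD⁻ ⟩
    τL v L₁           ∎

pvdAt⇒negativeMaximal : ∀ v D → T (occC v D) → PVDAt v D → Any Negative (Cmax v D)
pvdAt⇒negativeMaximal v D occ pvd with τC-attained v D occ
... | L₀ , L₀∈D , occL₀ , τL₀≡τD with negative-or-positive L₀
...   | inj₁ negL₀ = lose (∈-Cmax⁺ v L₀∈D occL₀ τL₀≡τD) negL₀
...   | inj₂ posL₀ = pvdAt∧positiveMaximal⇒negativeMaximal v D pvd
                       (∈-filter⁺ (T? ∘ pos) {xs = D} L₀∈D posL₀) occL₀ τL₀≡τD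

pvdClause⇔negativeMaximal : ∀ D → PVDClause D ⇔ (∀ v → T (occC v D) → Any Negative (Cmax v D))
pvdClause⇔negativeMaximal D = mk⇔
  (λ pvd v occ → pvdAt⇒negativeMaximal v D occ (pvd v))
  (λ negMax v occD⁺ → negativeMaximal⇒pvdAt v D (negMax v (occC-filterᵇ⁻ v pos D occD⁺)) occD⁺)

PVD-map⇔ : ∀ (f : Clause → Clause) S → PVD (map f S) ⇔ (∀ C → C ∈ S → PVDClause (f C))
PVD-map⇔ f S = mk⇔
  (λ pvd C C∈S → pvd (f C) (∈-map⁺ f C∈S))
  (λ pvd D D∈ → let C , C∈S , D≡fC = ∈-map⁻ f D∈ in subst PVDClause (sym D≡fC) (pvd C C∈S))

args-renL : ∀ r L → args (renL r L) ≡ args L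
args-renL r (lit b P ts) with r P
... | true  = refl
... | false = refl

occL-renL : ∀ r v L → occL v (renL r L) ≡ occL v L
occL-renL r v L = cong (occTs v) (args-renL r L)

τL-renL : ∀ r v L → τL v (renL r L) ≡ τL v L
τL-renL r v L = cong (τTs v) (args-renL r L)

occC-renC : ∀ r v C → occC v (renC r C) ≡ occC v C
occC-renC r v []      = refl
occC-renC r v (L ∷ C) = cong₂ _∨_ (occL-renL r v L) (occC-renC r v C)

τC-renC : ∀ r v C → τC v (renC r C) ≡ τC v C
τC-renC r v []      = refl
τC-renC r v (L ∷ C) rewrite occL-renL r v L | τL-renL r v L | τC-renC r v C = refl

Cmax-renC : ∀ r v C → Cmax v (renC r C) ≡ renC r (Cmax v C)
Cmax-renC r v C rewrite τC-renC r v C = filterᵇ-map _ (renL r) invariant C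
  where
  invariant : ∀ L → (occL v (renL r L) ∧ (τL v (renL r L) ≡ᵇ τC v C)) ≡ (occL v L ∧ (τL v L ≡ᵇ τC v C))
  invariant L rewrite occL-renL r v L | τL-renL r v L = refl

negative-renL⇔ : ∀ M L → Negative (renL M L) ⇔ SatPLit M (skelL L)
negative-renL⇔ M (lit b P ts) with M P | b
... | true  | true  = mk⇔ (λ _ → refl) (λ _ → tt)
... | true  | false = mk⇔ (λ ()) (λ ())
... | false | true  = mk⇔ (λ ()) (λ ())
... | false | false = mk⇔ (λ _ → refl) (λ _ → tt)

ModelOfMaxSkeletons : Interp → Clause → Set
ModelOfMaxSkeletons M C = ∀ v → T (occC v C) → SatPClause M (skel (Cmax v C))

negativeMaximal-renC⇔ : ∀ M v C → Any Negative (Cmax v (renC M C)) ⇔ SatPClause M (skel (Cmax v C))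
negativeMaximal-renC⇔ M v C rewrite Cmax-renC M v C = mk⇔
  (Anyₚ.map⁺ ∘ Any.map (to (negative-renL⇔ M _)) ∘ Anyₚ.map⁻)
  (Anyₚ.map⁺ ∘ Any.map (from (negative-renL⇔ M _)) ∘ Anyₚ.map⁻)

pvdClause-renC⇔ : ∀ M C → PVDClause (renC M C) ⇔ ModelOfMaxSkeletons M C
pvdClause-renC⇔ M C = ⇔-trans (pvdClause⇔negativeMaximal (renC M C)) (mk⇔
  (λ negMax v occ → to (negativeMaximal-renC⇔ M v C) (negMax v (subst T (sym (occC-renC M v C)) occ)))
  (λ model v occ → from (negativeMaximal-renC⇔ M v C) (model v (subst T (occC-renC M v C) occ))))

modelOfRen⇔ : ∀ M S → ModelOfRen M S ⇔ (∀ C → C ∈ S → ModelOfMaxSkeletons M C)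
modelOfRen⇔ M S = mk⇔
  (λ model C C∈S v occ → model _ (C , v , C∈S , occ , refl))
  (λ { model D (C , v , C∈S , occ , refl) → model C C∈S v occ })

mainTheorem3 : (S : ClauseSet) (M : Interp) →
                 PVD (renS (rOf M) S) ⇔ ModelOfRen M S
mainTheorem3 S M =
  ⇔-trans (PVD-map⇔ (renC M) S)
    (⇔-trans (∀∈-cong (pvdClause-renC⇔ M))
      (⇔-sym (modelOfRen⇔ M S)))
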